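{- Let $d\ge 3$, $h\ge 1$. The exponent $\exp(d,h)$ of the sandpile group $G(d,h)$ equals $$(d-1)^h\,\mathrm{lcm}\{d\,\theta(d,h+1),\ \theta(d,h),\ \theta(d,h-1),\dots,\theta(d,2)\},$$ where $\theta(d,n)=\frac{(d-1)^n-1}{d-2}$.
   Context: Let $\mathcal{T}(d,h)$ be the ball of radius $h$ about a root vertex $0$ in the infinite $d$-regular tree: the root has $d$ children, every vertex at depth $1\le n\le h-1$ has $d-1$ children, and the vertices at depth $h$ are the leaves. Let $V$ be its vertex set, $p(i)$ the parent of a non-root vertex $i$, $C_i$ the set of children of $i$, and $\{\mathbf{x}_i\}$ the standard basis of $\mathbb{Z}^V$. For $i\in V$ put $\delta_i = d\mathbf{x}_i - \mathbf{x}_{p(i)} - \sum_{j\in C_i}\mathbf{x}_j$ (omit $\mathbf{x}_{p(i)}$ for $i=0$; the sum is empty for leaves). The sandpile group is $G(d,h)=\mathbb{Z}^V/\sum_{i\in V}\mathbb{Z}\delta_i$. The exponent of a finite abelian group is the least common multiple of the orders of its elements. -}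

module Defs where

open import Data.Nat as ℕ using (ℕ; zero; suc; _∸_; _^_; _≤_; _<_; s≤s; z≤n; _≤?_; NonZero)
open import Data.Nat.Properties using (≤-trans; n≤1+n; m∸n≢0⇒n<m)
open import Data.Nat.Divisibility using (_∣_)
open import Data.Nat.DivMod using (_/_)
open import Data.Nat.LCM using (lcm)
open import Data.Fin using (Fin)
import Data.Fin as Fin
open import Data.Integer as ℤ using (ℤ; +_; _-_; _+_)
open import Data.List using (List; _∷_; []; map; foldr; upTo)
open import Data.Product using (Σ; Σ-syntax; _×_; _,_; ∃)
open import Relation.Nullary using (yes; no)
open import Relation.Binary.PropositionalEquality using (_≡_)

-- Node d n : vertices at depth n of the infinite d-regular tree rooted at 0.
-- The root has d children (top i), every other vertex has d-1 children (ext v j).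

data Node (d : ℕ) : ℕ → Set where
  root : Node d 0
  top  : Fin d → Node d 1
  ext  : ∀ {n} → Node d (suc n) → Fin (d ∸ 1) → Node d (suc (suc n))

parent : ∀ {d n} → Node d (suc n) → Node d n
parent (top i)   = root
parent (ext v j) = v

Vertex : ℕ → ℕ → Set
Vertex d h = Σ[ n ∈ ℕ ] (n ≤ h × Node d n)

sumFin : (k : ℕ) → (Fin k → ℤ) → ℤ
sumFin zero    f = + 0
sumFin (suc k) f = f Fin.zero + sumFin k (λ i → f (Fin.suc i))

childrenSum : ∀ {d n} → Node d n → (Node d (suc n) → ℤ) → ℤ
childrenSum {d} {zero}  root f = sumFin d (λ i → f (top i))
childrenSum {d} {suc n} v    f = sumFin (d ∸ 1) (λ j → f (ext v j))

childTerm : ∀ {d h} → (Vertex d h → ℤ) → (n : ℕ) → Node d n → ℤ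
childTerm {d} {h} c n v with suc n ≤? h
... | yes p = childrenSum v (λ w → c (suc n , p , w))
... | no  _ = + 0

parentTerm : ∀ {d h} → (Vertex d h → ℤ) → (n : ℕ) → n ≤ h → Node d n → ℤ
parentTerm c zero    le v = + 0
parentTerm c (suc n) le v = c (n , ≤-trans (n≤1+n n) le , parent v)

-- The v-coordinate of Σ_i c_i δ_i, written out:
-- (Σ_i c_i δ_i)_v = d c_v - c_{p(v)} - Σ_{j ∈ C_v} c_j.
combo : ∀ {d h} → (Vertex d h → ℤ) → Vertex d h → ℤ
combo {d} {h} c (n , le , v) =
  (+ d ℤ.* c (n , le , v)) - parentTerm c n le v - childTerm c n v

InLattice : (d h : ℕ) → (Vertex d h → ℤ) → Set
InLattice d h x = ∃ λ (c : Vertex d h → ℤ) → ∀ v → x v ≡ combo c v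

scale : ∀ {d h} → ℕ → (Vertex d h → ℤ) → (Vertex d h → ℤ)
scale k x v = + k ℤ.* x v

-- n is the order of the class of x in G(d,h) = ℤ^V / lattice
IsOrder : (d h : ℕ) → (Vertex d h → ℤ) → ℕ → Set
IsOrder d h x n =
  0 < n × InLattice d h (scale n x) ×
  (∀ k → 0 < k → InLattice d h (scale k x) → n ≤ k)

IsExponent : (d h : ℕ) → ℕ → Set
IsExponent d h e =
  (∀ x → ∃ λ n → IsOrder d h x n) ×
  (∀ x n → IsOrder d h x n → n ∣ e) ×
  (∀ m → (∀ x n → IsOrder d h x n → n ∣ m) → e ∣ m)

nonZero-d∸2 : ∀ {d} → 3 ≤ d → NonZero (d ∸ 2)
nonZero-d∸2 (s≤s (s≤s (s≤s _))) = _

θ : (d : ℕ) → 3 ≤ d → ℕ → ℕ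
θ d d≥3 n = ((d ∸ 1) ^ n ∸ 1) / (d ∸ 2)
  where instance _ = nonZero-d∸2 d≥3
  
lcmList : List ℕ → ℕ
lcmList = foldr lcm 1

expFormula : (d : ℕ) → 3 ≤ d → ℕ → ℕ
expFormula d d≥3 h =
  (d ∸ 1) ^ h ℕ.*
  lcmList (d ℕ.* θ d d≥3 (suc h) ∷ map (λ i → θ d d≥3 (2 ℕ.+ i)) (upTo (h ∸ 1)))

-- Write q = d - 1 and θₙ = θ(d,n) = 1 + q + ⋯ + qⁿ⁻¹, and let L be the Laplacian c ↦ combo c.
-- L is injective, and whenever e is a common multiple of d·qʰ·θₕ₊₁ and of all θₐ₊₁θₐ₊₂ (a < h)
-- there is an explicit integral C with L C = e·Y for every load Y; since consecutive θ's are
-- coprime to each other and to q, the claimed exponent is such a common multiple. Hence k·x lies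
-- in the relation lattice iff e divides k·C, so every order divides e. Conversely, evaluating C on
-- two families of test loads shows that any m annihilating the group is divisible by d·qʰ·θₕ₊₁ and
-- by every θₐ₊₂, which forces e ∣ m.

module Submission where

open import Defs
open import Data.Nat using (ℕ; _≤_; suc; s≤s; z≤n)

module Repunits where

  open import Data.List using (List; []; _∷_; map; upTo)
  open import Data.List.Relation.Unary.All as All using (All; []; _∷_)
  open import Data.List.Relation.Unary.All.Properties using (map⁺; map⁻)
  open import Data.List.Membership.Propositional.Properties using (∈-upTo⁺; ∈-upTo⁻)
  open import Data.Nat
  open import Data.Nat.Properties
  open import Data.Nat.Divisibility
  open import Data.Nat.Coprimality using (Coprime; coprime-divisor; coprime⇒gcd≡1)
  open import Data.Nat.DivMod using (m*n/n≡m)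
  open import Data.Nat.GCD using (gcd)
  open import Data.Nat.LCM using (lcm; m∣lcm[m,n]; n∣lcm[m,n]; lcm-least; gcd*lcm)
  open import Data.Sum using (inj₁; inj₂)
  open import Data.Nat.Tactic.RingSolver using (solve-∀)
  open import Data.Product using (_,_)
  open import Relation.Binary.PropositionalEquality
  open ≡-Reasoning

  repunit : ℕ → ℕ → ℕ
  repunit q zero    = 0
  repunit q (suc n) = 1 + repunit q n * q

  repunit-suc : ∀ q n → repunit q (suc n) ≡ repunit q n + q ^ n
  repunit-suc q zero    = refl
  repunit-suc q (suc n) = begin
    1 + (1 + repunit q n * q) * q  ≡⟨ cong (λ r → 1 + r * q) (repunit-suc q n) ⟩
    1 + (repunit q n + q ^ n) * q  ≡⟨ rearrange q (repunit q n) (q ^ n) ⟩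
    1 + repunit q n * q + q * q ^ n ∎
    where
    rearrange : ∀ q r p → 1 + (r + p) * q ≡ 1 + r * q + q * p
    rearrange = solve-∀

  pow≡1+repunit* : ∀ k n → suc (suc k) ^ n ≡ 1 + repunit (2 + k) n * suc k
  pow≡1+repunit* k zero    = refl
  pow≡1+repunit* k (suc n) = begin
    (2 + k) * (2 + k) ^ n               ≡⟨ cong ((2 + k) *_) (pow≡1+repunit* k n) ⟩
    (2 + k) * (1 + repunit (2 + k) n * suc k) ≡⟨ rearrange k (repunit (2 + k) n) ⟩
    1 + (1 + repunit (2 + k) n * (2 + k)) * suc k ∎
    where
    rearrange : ∀ k r → (2 + k) * (1 + r * suc k) ≡ 1 + (1 + r * (2 + k)) * suc k
    rearrange = solve-∀

  θ≡repunit : ∀ k (d≥3 : 3 ≤ 3 + k) n → θ (3 + k) d≥3 n ≡ repunit (2 + k) n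
  θ≡repunit k d≥3 n =
    trans (cong (λ p → (p ∸ 1) / suc k) (pow≡1+repunit* k n)) (m*n/n≡m (repunit (2 + k) n) (suc k))

  repunit-coprime-suc : ∀ q n → Coprime (repunit q n) (repunit q (suc n))
  repunit-coprime-suc q n {i} (i∣r , i∣r′) =
    ∣1⇒≡1 (∣m+n∣m⇒∣n (subst (i ∣_) (+-comm 1 (repunit q n * q)) i∣r′) (∣m⇒∣m*n q i∣r))

  repunit-suc-coprime-base : ∀ q n → Coprime (repunit q (suc n)) q
  repunit-suc-coprime-base q n {i} (i∣r , i∣q) =
    ∣1⇒≡1 (∣m+n∣m⇒∣n (subst (i ∣_) (+-comm 1 (repunit q n * q)) i∣r) (∣n⇒∣m*n (repunit q n) i∣q))

  coprime-∣^*⇒∣ : ∀ {t q} n {m} → Coprime t q → t ∣ q ^ n * m → t ∣ m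
  coprime-∣^*⇒∣ {t}         zero    {m} t⊥q t∣ = subst (t ∣_) (+-identityʳ m) t∣
  coprime-∣^*⇒∣ {t} {q = q} (suc n) {m} t⊥q t∣ =
    coprime-∣^*⇒∣ n t⊥q (coprime-divisor t⊥q (subst (t ∣_) (*-assoc q (q ^ n) m) t∣))

  coprime-∣⇒*∣ : ∀ {a b c} → Coprime a b → a ∣ c → b ∣ c → a * b ∣ c
  coprime-∣⇒*∣ {a} {b} a⊥b a∣c b∣c = subst (_∣ _) lcm≡* (lcm-least a∣c b∣c)
    where
    lcm≡* : lcm a b ≡ a * b
    lcm≡* = trans (sym (*-identityˡ (lcm a b)))
              (trans (cong (_* lcm a b) (sym (coprime⇒gcd≡1 a⊥b))) (gcd*lcm a b))

  lcm-nonZero : ∀ m n .{{_ : NonZero m}} .{{_ : NonZero n}} → NonZero (lcm m n)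
  lcm-nonZero m n = ≢-nonZero λ lcm≡0 → ≢-nonZero⁻¹ (m * n) {{m*n≢0 m n}} (begin
    m * n               ≡⟨ gcd*lcm m n ⟨
    gcd m n * lcm m n   ≡⟨ cong (gcd m n *_) lcm≡0 ⟩
    gcd m n * 0         ≡⟨ *-zeroʳ (gcd m n) ⟩
    0                   ∎)

  lcmList-nonZero : ∀ {xs} → All NonZero xs → NonZero (lcmList xs)
  lcmList-nonZero []                = _
  lcmList-nonZero {x ∷ xs} (x≢0 ∷ xs≢0) =
    lcm-nonZero x (lcmList xs) {{x≢0}} {{lcmList-nonZero xs≢0}}

  ∣lcmList : ∀ xs → All (_∣ lcmList xs) xs
  ∣lcmList []       = []
  ∣lcmList (x ∷ xs) = m∣lcm[m,n] x (lcmList xs)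
                    ∷ All.map (λ y∣ → ∣-trans y∣ (n∣lcm[m,n] x (lcmList xs))) (∣lcmList xs)

  lcmList-least : ∀ {xs m} → All (_∣ m) xs → lcmList xs ∣ m
  lcmList-least []           = 1∣ _
  lcmList-least (x∣m ∷ xs∣m) = lcm-least x∣m (lcmList-least xs∣m)

  module ExponentFormula (k h′ : ℕ) where

    d q h : ℕ
    d = 3 + k
    q = 2 + k
    h = suc h′

    d≥3 : 3 ≤ d
    d≥3 = s≤s (s≤s (s≤s z≤n))

    moduli : List ℕ
    moduli = d * θ d d≥3 (suc h) ∷ map (λ i → θ d d≥3 (2 + i)) (upTo h′)

    e : ℕ
    e = expFormula d d≥3 h

    rootModulus : ℕ
    rootModulus = d * q ^ h * repunit q (suc h)

    head∣moduli : d * repunit q (suc h) ∣ lcmList moduli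
    head∣moduli = subst (λ r → d * r ∣ lcmList moduli) (θ≡repunit k d≥3 (suc h))
                        (All.head (∣lcmList moduli))

    repunit∣moduli : ∀ i → i ≤ h → repunit q (suc i) ∣ lcmList moduli
    repunit∣moduli zero    _         = 1∣ _
    repunit∣moduli (suc a) (s≤s a≤h′) with m≤n⇒m<n∨m≡n a≤h′
    ... | inj₁ a<h′ = subst (_∣ lcmList moduli) (θ≡repunit k d≥3 (2 + a))
                        (All.lookup (map⁻ (All.tail (∣lcmList moduli))) (∈-upTo⁺ a<h′))
    ... | inj₂ refl = ∣-trans (n∣m*n d) head∣moduli

    e-nonZero : NonZero e
    e-nonZero = m*n≢0 (q ^ h) (lcmList moduli) {{m^n≢0 q h}} {{lcmList-nonZero moduli≢0}}
      where
      moduli≢0 : All NonZero moduli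
      moduli≢0 = subst (λ r → NonZero (d * r)) (sym (θ≡repunit k d≥3 (suc h))) _
               ∷ map⁺ (All.tabulate λ {i} _ → subst NonZero (sym (θ≡repunit k d≥3 (2 + i))) _)

    rootModulus∣e : rootModulus ∣ e
    rootModulus∣e = subst (_∣ e) (rearrange d (q ^ h) (repunit q (suc h)))
                          (*-monoʳ-∣ (q ^ h) head∣moduli)
      where
      rearrange : ∀ d p r → p * (d * r) ≡ d * p * r
      rearrange = solve-∀

    consecutive∣e : ∀ a → a < h → repunit q (suc a) * repunit q (2 + a) ∣ e
    consecutive∣e a a<h = ∣-trans
      (coprime-∣⇒*∣ (repunit-coprime-suc q (suc a)) (repunit∣moduli a (<⇒≤ a<h)) (repunit∣moduli (suc a) a<h))
      (n∣m*n (q ^ h))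

    e∣ : ∀ {m} → rootModulus ∣ m → (∀ a → a < h → repunit q (2 + a) ∣ m) → e ∣ m
    e∣ {m} (divides t m≡) repunits∣m = subst (e ∣_) (sym m≡q^h*m′) (*-monoʳ-∣ (q ^ h) moduli∣m′)
      where
      m′ : ℕ
      m′ = t * (d * repunit q (suc h))

      m≡q^h*m′ : m ≡ q ^ h * m′
      m≡q^h*m′ = trans m≡ (rearrange t d (q ^ h) (repunit q (suc h)))
        where
        rearrange : ∀ t d p r → t * (d * p * r) ≡ p * (t * (d * r))
        rearrange = solve-∀

      moduli∣m′ : lcmList moduli ∣ m′
      moduli∣m′ = lcmList-least
        ( subst (λ r → d * r ∣ m′) (sym (θ≡repunit k d≥3 (suc h))) (n∣m*n t)
        ∷ map⁺ (All.tabulate λ {i} i∈ → subst (_∣ m′) (sym (θ≡repunit k d≥3 (2 + i)))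
            (coprime-∣^*⇒∣ h (repunit-suc-coprime-base q (suc i))
              (subst (_ ∣_) m≡q^h*m′ (repunits∣m i (m≤n⇒m≤1+n (∈-upTo⁻ i∈)))))))

module FinSums where

  open import Data.Nat using (zero; suc)
  open import Data.Integer using (ℤ; +_; _+_; _*_; 0ℤ; 1ℤ)
  open import Data.Integer.Properties using (*-zeroˡ)
  open import Data.Integer.Tactic.RingSolver using (solve-∀)
  open import Data.Fin using (Fin)
  import Data.Fin as Fin
  open import Relation.Binary.PropositionalEquality

  sumFin-cong : ∀ m {f g : Fin m → ℤ} → (∀ i → f i ≡ g i) → sumFin m f ≡ sumFin m g
  sumFin-cong zero    f≡g = refl
  sumFin-cong (suc m) f≡g = cong₂ _+_ (f≡g Fin.zero) (sumFin-cong m (λ i → f≡g (Fin.suc i)))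

  sumFin-linear : ∀ m a b (f g : Fin m → ℤ) →
                  sumFin m (λ i → a * f i + b * g i) ≡ a * sumFin m f + b * sumFin m g
  sumFin-linear zero    a b f g = distrib-0 a b
    where
    distrib-0 : ∀ a b → 0ℤ ≡ a * 0ℤ + b * 0ℤ
    distrib-0 = solve-∀
  sumFin-linear (suc m) a b f g =
    trans (cong (_+_ (a * f Fin.zero + b * g Fin.zero))
                (sumFin-linear m a b (λ i → f (Fin.suc i)) (λ i → g (Fin.suc i))))
          (distrib-+ a b (f Fin.zero) (g Fin.zero) _ _)
    where
    distrib-+ : ∀ a b x y s t → a * x + b * y + (a * s + b * t) ≡ a * (x + s) + b * (y + t)
    distrib-+ = solve-∀

  sumFin-const : ∀ m c → sumFin m (λ _ → c) ≡ + m * c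
  sumFin-const zero    c = sym (*-zeroˡ c)
  sumFin-const (suc m) c = trans (cong (_+_ c) (sumFin-const m c)) (suc-* (+ m) c)
    where
    suc-* : ∀ m c → c + m * c ≡ (1ℤ + m) * c
    suc-* = solve-∀

module Laplacian (d h : ℕ) where

  open import Data.Nat as ℕ using (zero; suc; _∸_; s≤s; _≤?_)
  open import Data.Nat.Properties using (≤-irrelevant; allUpTo?)
  open import Data.Integer using (ℤ; +_; _+_; _-_; _*_; 0ℤ; 1ℤ)
  open import Data.Integer.Properties using (+-identityˡ; *-zeroʳ; *-comm)
  open import Data.Integer.Tactic.RingSolver using (solve-∀)
  open import Data.Fin using (Fin)
  open import Data.Fin.Properties using (all?)
  open import Function using (_∘_)
  open import Data.Product using (_,_)
  open import Relation.Nullary using (Dec; yes; no; ¬_; contradiction)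
  open import Relation.Nullary.Decidable using (map′)
  open import Relation.Unary using (Decidable)
  open import Relation.Binary.PropositionalEquality
  open ≡-Reasoning
  open FinSums

  V : Set
  V = Vertex d h

  arity : ℕ → ℕ
  arity zero    = d
  arity (suc _) = d ∸ 1

  childrenSum-cong : ∀ {n} (v : Node d n) {f g : Node d (suc n) → ℤ} →
                     (∀ w → parent w ≡ v → f w ≡ g w) → childrenSum v f ≡ childrenSum v g
  childrenSum-cong {zero}  root f≡g = sumFin-cong d (λ i → f≡g (top i) refl)
  childrenSum-cong {suc n} v    f≡g = sumFin-cong (d ∸ 1) (λ j → f≡g (ext v j) refl)

  childrenSum-linear : ∀ {n} (v : Node d n) a b (f g : Node d (suc n) → ℤ) →
    childrenSum v (λ w → a * f w + b * g w) ≡ a * childrenSum v f + b * childrenSum v g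
  childrenSum-linear {zero}  root a b f g = sumFin-linear d a b _ _
  childrenSum-linear {suc n} v    a b f g = sumFin-linear (d ∸ 1) a b _ _

  childrenSum-const : ∀ {n} (v : Node d n) c → childrenSum v (λ _ → c) ≡ + arity n * c
  childrenSum-const {zero}  root c = sumFin-const d c
  childrenSum-const {suc n} v    c = sumFin-const (d ∸ 1) c

  childrenSum-affine : ∀ {n} (v : Node d n) a b (f : Node d (suc n) → ℤ) →
    childrenSum v (λ w → a + b * f w) ≡ + arity n * a + b * childrenSum v f
  childrenSum-affine {n} v a b f = begin
    childrenSum v (λ w → a + b * f w)                  ≡⟨ childrenSum-cong v (λ w _ → a≡a*1 a (b * f w)) ⟩
    childrenSum v (λ w → a * 1ℤ + b * f w)             ≡⟨ childrenSum-linear v a b (λ _ → 1ℤ) f ⟩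
    a * childrenSum v (λ _ → 1ℤ) + b * childrenSum v f ≡⟨ cong (λ s → a * s + b * childrenSum v f) (childrenSum-const v 1ℤ) ⟩
    a * (+ arity n * 1ℤ) + b * childrenSum v f        ≡⟨ commute a (+ arity n) (b * childrenSum v f) ⟩
    + arity n * a + b * childrenSum v f               ∎
    where
    a≡a*1 : ∀ a x → a + x ≡ a * 1ℤ + x
    a≡a*1 = solve-∀
    commute : ∀ a m x → a * (m * 1ℤ) + x ≡ m * a + x
    commute = solve-∀

  childrenSum-scale : ∀ {n} (v : Node d n) b (f : Node d (suc n) → ℤ) →
    childrenSum v (λ w → b * f w) ≡ b * childrenSum v f
  childrenSum-scale {n} v b f = begin
    childrenSum v (λ w → b * f w)            ≡⟨ childrenSum-cong v (λ w _ → sym (+-identityˡ (b * f w))) ⟩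
    childrenSum v (λ w → 0ℤ + b * f w)       ≡⟨ childrenSum-affine v 0ℤ b f ⟩
    + arity n * 0ℤ + b * childrenSum v f     ≡⟨ cong (_+ b * childrenSum v f) (*-zeroʳ (+ arity n)) ⟩
    0ℤ + b * childrenSum v f                 ≡⟨ +-identityˡ _ ⟩
    b * childrenSum v f                      ∎

  value-irrelevant : (c : V → ℤ) {n : ℕ} (p p′ : n ≤ h) (v : Node d n) → c (n , p , v) ≡ c (n , p′ , v)
  value-irrelevant c p p′ v = cong (λ p → c (_ , p , v)) (≤-irrelevant p p′)

  childTerm-internal : (c : V → ℤ) {n : ℕ} (v : Node d n) (p : suc n ≤ h) →
                       childTerm c n v ≡ childrenSum v (λ w → c (suc n , p , w))
  childTerm-internal c {n} v p with suc n ≤? h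
  ... | yes p′ = childrenSum-cong v (λ w _ → value-irrelevant c p′ p w)
  ... | no ¬p  = contradiction p ¬p

  childTerm-leaf : (c : V → ℤ) {n : ℕ} (v : Node d n) → ¬ suc n ≤ h → childTerm c n v ≡ 0ℤ
  childTerm-leaf c {n} v ¬p with suc n ≤? h
  ... | yes p = contradiction p ¬p
  ... | no _  = refl

  combo-linear : ∀ a b (f g : V → ℤ) w →
                 combo (λ u → a * f u + b * g u) w ≡ a * combo f w + b * combo g w
  combo-linear a b f g (n , p , v) = begin
    + d * (a * f (n , p , v) + b * g (n , p , v)) - parentTerm fg n p v - childTerm fg n v
      ≡⟨ cong₂ (λ s t → + d * (a * f (n , p , v) + b * g (n , p , v)) - s - t) (parentTerm-linear n p v) (childTerm-linear n v) ⟩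
    + d * (a * f (n , p , v) + b * g (n , p , v))
      - (a * parentTerm f n p v + b * parentTerm g n p v) - (a * childTerm f n v + b * childTerm g n v)
      ≡⟨ collect (+ d) a b _ _ _ _ _ _ ⟩
    a * combo f (n , p , v) + b * combo g (n , p , v) ∎
    where
    fg : V → ℤ
    fg u = a * f u + b * g u

    collect : ∀ d a b x y s t s′ t′ →
      d * (a * x + b * y) - (a * s + b * t) - (a * s′ + b * t′) ≡ a * (d * x - s - s′) + b * (d * y - t - t′)
    collect = solve-∀

    zero-linear : ∀ a b → 0ℤ ≡ a * 0ℤ + b * 0ℤ
    zero-linear = solve-∀

    parentTerm-linear : ∀ n p v → parentTerm fg n p v ≡ a * parentTerm f n p v + b * parentTerm g n p v
    parentTerm-linear zero    p v = zero-linear a b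
    parentTerm-linear (suc n) p v = refl

    childTerm-linear : ∀ n v → childTerm fg n v ≡ a * childTerm f n v + b * childTerm g n v
    childTerm-linear n v with suc n ≤? h
    ... | yes _ = childrenSum-linear v a b _ _
    ... | no  _ = zero-linear a b

  combo-cong : ∀ {f g : V → ℤ} → (∀ u → f u ≡ g u) → ∀ w → combo f w ≡ combo g w
  combo-cong {f} {g} f≡g (n , p , v) =
    cong₂ _-_ (cong₂ _-_ (cong (+ d *_) (f≡g _)) (parentTerm-cong n p v)) (childTerm-cong n v)
    where
    parentTerm-cong : ∀ n p v → parentTerm f n p v ≡ parentTerm g n p v
    parentTerm-cong zero    p v = refl
    parentTerm-cong (suc n) p v = f≡g _

    childTerm-cong : ∀ n v → childTerm f n v ≡ childTerm g n v
    childTerm-cong n v with suc n ≤? h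
    ... | yes _ = childrenSum-cong v (λ w _ → f≡g _)
    ... | no  _ = refl

  combo-scale : ∀ a (f : V → ℤ) w → combo (λ u → a * f u) w ≡ a * combo f w
  combo-scale a f w = begin
    combo (λ u → a * f u) w                ≡⟨ combo-cong (λ u → add-0* a (f u)) w ⟩
    combo (λ u → a * f u + 0ℤ * f u) w     ≡⟨ combo-linear a 0ℤ f f w ⟩
    a * combo f w + 0ℤ * combo f w         ≡⟨ add-0* a (combo f w) ⟨
    a * combo f w                          ∎
    where
    add-0* : ∀ a x → a * x ≡ a * x + 0ℤ * x
    add-0* = solve-∀

  allNodes? : ∀ n {P : Node d n → Set} → Decidable P → Dec (∀ v → P v)
  allNodes? zero          P? with P? root
  ... | yes P-root = yes λ { root → P-root }
  ... | no ¬P-root = no λ all → ¬P-root (all root)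
  allNodes? (suc zero)    P? = map′ (λ all → λ { (top i) → all i }) (λ all i → all (top i)) (all? (P? ∘ top))
  allNodes? (suc (suc n)) P? =
    map′ (λ all → λ { (ext v j) → all v j }) (λ all v j → all (ext v j))
         (allNodes? (suc n) (λ v → all? (λ j → P? (ext v j))))

  allVertices? : ∀ {P : V → Set} → Decidable P → Dec (∀ w → P w)
  allVertices? {P} P? =
    map′ (λ all → λ { (n , p , v) → all (s≤s p) p v }) (λ all {n} _ p v → all (n , p , v))
         (allUpTo? atDepth? (suc h))
    where
    AtDepth : ℕ → Set
    AtDepth n = (p : n ≤ h) (v : Node d n) → P (n , p , v)

    atDepth? : Decidable AtDepth
    atDepth? n with n ≤? h
    ... | no  n≰h = yes (λ p → contradiction p n≰h)
    ... | yes p₀  = map′ (λ all p v → subst (λ p → P (n , p , v)) (≤-irrelevant p₀ p) (all v))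
                         (λ all v → all p₀ v)
                         (allNodes? n (λ v → P? (n , p₀ , v)))

  childrenSum-zero : ∀ {n} (v : Node d n) {f : Node d (suc n) → ℤ} → (∀ u → f u ≡ 0ℤ) → childrenSum v f ≡ 0ℤ
  childrenSum-zero {n} v f≡0 =
    trans (childrenSum-cong v (λ u _ → f≡0 u)) (trans (childrenSum-const v 0ℤ) (*-zeroʳ (+ arity n)))

  childrenSum-proportional : ∀ {n} (v : Node d n) (f : Node d (suc n) → ℤ) a x y →
    (∀ u → parent u ≡ v → a * x ≡ f u * y) → y * childrenSum v f ≡ + arity n * (a * x)
  childrenSum-proportional {n} v f a x y prop = begin
    y * childrenSum v f            ≡⟨ childrenSum-scale v y f ⟨
    childrenSum v (λ u → y * f u)  ≡⟨ childrenSum-cong v (λ u u∈v → trans (*-comm y (f u)) (sym (prop u u∈v))) ⟩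
    childrenSum v (λ _ → a * x)    ≡⟨ childrenSum-const v (a * x) ⟩
    + arity n * (a * x)            ∎

module LeastWitness where

  open import Data.Nat using (_<_)
  open import Data.Nat.Properties using (anyUpTo?; ≮⇒≥)
  open import Data.Nat.Induction using (<-rec)
  open import Data.Product using (Σ; _×_; _,_)
  open import Relation.Nullary using (yes; no)
  open import Relation.Unary using (Decidable)

  Least : (ℕ → Set) → Set
  Least P = Σ ℕ λ m → P m × (∀ j → P j → m ≤ j)

  least : ∀ {P : ℕ → Set} → Decidable P → ∀ n → P n → Least P
  least {P} P? = <-rec (λ n → P n → Least P) step
    where
    step : ∀ n → (∀ {j} → j < n → P j → Least P) → P n → Least P
    step n smaller Pn with anyUpTo? P? n
    ... | yes (j , j<n , Pj) = smaller j<n Pj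
    ... | no  ∄j<n           = n , Pn , λ j Pj → ≮⇒≥ (λ j<n → ∄j<n (j , j<n , Pj))

module Orders (d h e : ℕ) where

  open import Data.Nat as ℕ using (zero; suc; _<_; _%_; _/_; NonZero; s≤s; z≤n; _<?_)
  open import Data.Nat.Properties as ℕ using (<⇒≱)
  open import Data.Nat.Divisibility as ℕ using (divides; m%n≡0⇒n∣m)
  open import Data.Nat.DivMod using (m%n<n; m≡m%n+[m/n]*n)
  open import Data.Integer using (ℤ; +_; _+_; _-_; _*_; -_; 0ℤ)
  open import Data.Integer.Properties using (*-comm; *-assoc; *-cancelˡ-≡; pos-*)
  open import Data.Integer.Divisibility.Signed using (_∣_; divides; _∣?_; ∣-refl; ∣n⇒∣m*n; ∣m⇒∣m*n; ∣m∣n⇒∣m-n)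
  open import Data.Integer.Tactic.RingSolver using (solve-∀)
  open import Data.Product using (Σ; ∃; _×_; _,_; proj₁; proj₂)
  open import Relation.Nullary using (Dec; contradiction)
  open import Relation.Nullary.Decidable using (_×-dec_)
  open import Relation.Binary.PropositionalEquality
  open ≡-Reasoning
  open Laplacian d h using (V; combo-linear; combo-scale; combo-cong; allVertices?)
  open LeastWitness using (least)

  Solution : (V → ℤ) → (V → ℤ) → Set
  Solution x C = ∀ w → combo C w ≡ + e * x w

  DivisibleSolution : ℕ → (V → ℤ) → Set
  DivisibleSolution k C = ∀ w → + e ∣ + k * C w

  -- As L is injective, k·x = L c forces e·c = k·C for any solution C, so k·x lies in the lattice iff e ∣ k·C.
  module _ .{{e≢0 : NonZero e}}
           (harmonic⇒zero : (c : V → ℤ) → (∀ w → combo c w ≡ 0ℤ) → ∀ w → c w ≡ 0ℤ)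
           (solvable : ∀ x → Σ (V → ℤ) (Solution x)) where

    inLattice⇒divisible : ∀ k {x C} → Solution x C → InLattice d h (scale k x) → DivisibleSolution k C
    inLattice⇒divisible k {x} {C} solves (c , kx≡Lc) w = divides (c w) (begin
      + k * C w                                ≡⟨ rearrange (+ e) (+ k) (c w) (C w) ⟩
      c w * + e - (+ e * c w + - + k * C w)    ≡⟨ cong (_-_ (c w * + e)) (harmonic⇒zero f Lf≡0 w) ⟩
      c w * + e - 0ℤ                           ≡⟨ cancel (c w * + e) ⟩
      c w * + e                                ∎)
      where
      f : V → ℤ
      f u = + e * c u + - + k * C u

      Lf≡0 : ∀ u → combo f u ≡ 0ℤ
      Lf≡0 u = begin
        combo f u                                ≡⟨ combo-linear (+ e) (- + k) c C u ⟩
        + e * combo c u + - + k * combo C u      ≡⟨ cong₂ (λ a b → + e * a + - + k * b) (sym (kx≡Lc u)) (solves u) ⟩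
        + e * (+ k * x u) + - + k * (+ e * x u)  ≡⟨ vanish (+ e) (+ k) (x u) ⟩
        0ℤ                                       ∎
        where
        vanish : ∀ a b y → a * (b * y) + - b * (a * y) ≡ 0ℤ
        vanish = solve-∀

      rearrange : ∀ a b y g → b * g ≡ y * a - (a * y + - b * g)
      rearrange = solve-∀
      cancel : ∀ a → a - 0ℤ ≡ a
      cancel = solve-∀

    divisible⇒inLattice : ∀ k {x C} → Solution x C → DivisibleSolution k C → InLattice d h (scale k x)
    divisible⇒inLattice k {x} {C} solves e∣ = c , λ w → sym (*-cancelˡ-≡ (+ e) (combo c w) (+ k * x w) (begin
      + e * combo c w            ≡⟨ combo-scale (+ e) c w ⟨
      combo (λ u → + e * c u) w   ≡⟨ combo-cong (λ u → trans (*-comm (+ e) (c u)) (sym (_∣_.equality (e∣ u)))) w ⟩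
      combo (λ u → + k * C u) w   ≡⟨ combo-scale (+ k) C w ⟩
      + k * combo C w             ≡⟨ cong (+ k *_) (solves w) ⟩
      + k * (+ e * x w)           ≡⟨ swap (+ k) (+ e) (x w) ⟩
      + e * (+ k * x w)           ∎))
      where
      c : V → ℤ
      c u = _∣_.quotient (e∣ u)
      swap : ∀ a b y → a * (b * y) ≡ b * (a * y)
      swap = solve-∀

    divisible? : ∀ k C → Dec (DivisibleSolution k C)
    divisible? k C = allVertices? (λ w → + e ∣? + k * C w)

    divisible-e : ∀ C → DivisibleSolution e C
    divisible-e C w = ∣m⇒∣m*n (C w) ∣-refl

    divisible-* : ∀ t {n} C → DivisibleSolution n C → DivisibleSolution (t ℕ.* n) C
    divisible-* t {n} C e∣ w = subst (+ e ∣_) regroup (∣n⇒∣m*n (+ t) (e∣ w))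
      where
      regroup : + t * (+ n * C w) ≡ + (t ℕ.* n) * C w
      regroup = trans (sym (*-assoc (+ t) (+ n) (C w))) (cong (_* C w) (sym (pos-* t n)))

    divisible-% : ∀ n .{{_ : NonZero n}} C → DivisibleSolution n C → DivisibleSolution (e % n) C
    divisible-% n C e∣ w = subst (+ e ∣_) (sym remainder) (∣m∣n⇒∣m-n (divisible-e C w) (∣n⇒∣m*n (+ (e / n)) (e∣ w)))
      where
      division : + e ≡ + (e % n) + + (e / n) * + n
      division = begin
        + e                          ≡⟨ cong +_ (m≡m%n+[m/n]*n e n) ⟩
        + (e % n ℕ.+ e / n ℕ.* n)    ≡⟨ cong (_+_ (+ (e % n))) (pos-* (e / n) n) ⟩
        + (e % n) + + (e / n) * + n  ∎
      remainder : + (e % n) * C w ≡ + e * C w - + (e / n) * (+ n * C w)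
      remainder = begin
        + (e % n) * C w
          ≡⟨ rearrange (+ (e % n)) (+ (e / n)) (+ n) (C w) ⟩
        (+ (e % n) + + (e / n) * + n) * C w - + (e / n) * (+ n * C w)
          ≡⟨ cong (λ a → a * C w - + (e / n) * (+ n * C w)) division ⟨
        + e * C w - + (e / n) * (+ n * C w) ∎
        where
        rearrange : ∀ r q n g → r * g ≡ (r + q * n) * g - q * (n * g)
        rearrange = solve-∀

    order-exists : ∀ x → ∃ λ n → IsOrder d h x n
    order-exists x with solvable x
    ... | C , solves with least (λ k → (0 <? k) ×-dec divisible? k C) e (ℕ.>-nonZero⁻¹ e , divisible-e C)
    ... | n , (0<n , e∣nC) , minimal =
      n , 0<n , divisible⇒inLattice n solves e∣nC ,
      λ k 0<k inLattice → minimal k (0<k , inLattice⇒divisible k solves inLattice)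

    order∣e : ∀ x n → IsOrder d h x n → n ℕ.∣ e
    order∣e x n (0<n , inLattice , minimal) = m%n≡0⇒n∣m e n (remainder≡0 (e % n) refl)
      where
      instance
        n≢0 : NonZero n
        n≢0 = ℕ.>-nonZero 0<n
      C : V → ℤ
      C = proj₁ (solvable x)
      solves : Solution x C
      solves = proj₂ (solvable x)
      remainder≡0 : ∀ r → e % n ≡ r → r ≡ 0
      remainder≡0 zero    _       = refl
      remainder≡0 (suc r) e%n≡1+r = contradiction
        (minimal (suc r) (s≤s z≤n) (divisible⇒inLattice (suc r) solves
          (subst (λ k → DivisibleSolution k C) e%n≡1+r (divisible-% n C (inLattice⇒divisible n solves inLattice)))))
        (<⇒≱ (subst (_< n) e%n≡1+r (m%n<n e n)))

    isExponent : (∀ m → (∀ x C → Solution x C → DivisibleSolution m C) → e ℕ.∣ m) → IsExponent d h e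
    isExponent e∣ = order-exists , order∣e , λ m orders∣m → e∣ m λ x C solves →
      let n , order = order-exists x in divisible-multiple solves (orders∣m x n order) order
      where
      divisible-multiple : ∀ {m n x C} → Solution x C → n ℕ.∣ m → IsOrder d h x n → DivisibleSolution m C
      divisible-multiple {n = n} {C = C} solves (divides t refl) (_ , inLattice , _) =
        divisible-* t C (inLattice⇒divisible n solves inLattice)

module Tree (k h′ : ℕ) where

  open import Data.Nat as ℕ using (zero; suc; _∸_; _<_; _^_; s≤s)
  open import Data.Nat.Properties as ℕ using ()
  open import Data.Integer using (ℤ; +_; _+_; _*_; 0ℤ; 1ℤ; NonZero)
  open import Data.Integer.Properties using (pos-*)
  open import Data.Product using (_,_)
  open import Relation.Nullary using (¬_; yes; no; contradiction)
  open import Relation.Binary.PropositionalEquality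
  open ≡-Reasoning
  open Repunits using (repunit; repunit-suc)
  open Repunits.ExponentFormula k h′ using (q; d; h) public

  open Laplacian d h public

  -- Unlike + repunit q n, Θ unfolds definitionally: the ring identities below see Θ (suc n) as 1 + Θ n · q.
  Θ : ℕ → ℤ
  Θ zero    = 0ℤ
  Θ (suc n) = 1ℤ + Θ n * + q

  +repunit≡Θ : ∀ n → + repunit q n ≡ Θ n
  +repunit≡Θ zero    = refl
  +repunit≡Θ (suc n) = begin
    + (1 ℕ.+ repunit q n ℕ.* q)  ≡⟨ cong (_+_ 1ℤ) (pos-* (repunit q n) q) ⟩
    1ℤ + + repunit q n * + q     ≡⟨ cong (λ r → 1ℤ + r * + q) (+repunit≡Θ n) ⟩
    1ℤ + Θ n * + q               ∎

  Θ-suc-nonZero : ∀ n → NonZero (Θ (suc n))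
  Θ-suc-nonZero n = subst NonZero (+repunit≡Θ (suc n)) _

  Θ-suc≡Θ+pow : ∀ n → Θ (suc n) ≡ Θ n + + (q ^ n)
  Θ-suc≡Θ+pow n = begin
    Θ (suc n)                  ≡⟨ +repunit≡Θ (suc n) ⟨
    + repunit q (suc n)        ≡⟨ cong +_ (repunit-suc q n) ⟩
    + repunit q n + + (q ^ n)  ≡⟨ cong (_+ + (q ^ n)) (+repunit≡Θ n) ⟩
    Θ n + + (q ^ n)            ∎

  height-suc : ∀ {n} → suc n ℕ.≤ h → h ∸ n ≡ suc (h ∸ suc n)
  height-suc = ℕ.+-∸-assoc 1

  height< : ∀ {n r} → h ∸ suc n ≡ r → r < h
  height< {n} height = subst (_< h) height (s≤s (ℕ.m∸n≤m h′ n))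

  height-zero⇒leaf : ∀ {n} → h ∸ suc n ≡ 0 → ¬ suc (suc n) ℕ.≤ h
  height-zero⇒leaf h∸n≡0 n<h = ℕ.<⇒≱ n<h (ℕ.m∸n≡0⇒m≤n h∸n≡0)

  height-suc⇒internal : ∀ {n a} → h ∸ suc n ≡ suc a → suc (suc n) ℕ.≤ h
  height-suc⇒internal h∸n≡suc = ℕ.m∸n≢0⇒n<m (λ h∸n≡0 → contradiction (trans (sym h∸n≡suc) h∸n≡0) λ ())

  atVertices : ((n : ℕ) → Node d n → ℤ) → V → ℤ
  atVertices Y (n , _ , v) = Y n v

  extend : (V → ℤ) → (n : ℕ) → Node d n → ℤ
  extend x n v with n ℕ.≤? h
  ... | yes p = x (n , p , v)
  ... | no  _ = 0ℤ

  atVertices-extend : ∀ x w → atVertices (extend x) w ≡ x w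
  atVertices-extend x (n , p , v) with n ℕ.≤? h
  ... | yes p′ = value-irrelevant x p′ p v
  ... | no  ¬p = contradiction p ¬p

module Kernel (k h′ : ℕ) where

  open import Data.Nat as ℕ using (zero; suc; _∸_; _^_; s≤s; z≤n)
  open import Data.Nat.Properties as ℕ using (≤-trans; n≤1+n)
  open import Data.Integer using (ℤ; +_; _+_; _-_; _*_; 0ℤ; 1ℤ; NonZero)
  open import Data.Integer.Properties using (pos-*; *-cancelʳ-≡; *-zeroˡ; +-identityʳ)
  open import Data.Integer.Tactic.RingSolver using (solve-∀)
  open import Data.Product using (_,_)
  open import Relation.Binary.PropositionalEquality
  open ≡-Reasoning
  open Tree k h′

  *-nonZero≡0⇒≡0 : ∀ x y .{{_ : NonZero y}} → x * y ≡ 0ℤ → x ≡ 0ℤ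
  *-nonZero≡0⇒≡0 x y x*y≡0 = *-cancelʳ-≡ x 0ℤ y (trans x*y≡0 (sym (*-zeroˡ y)))

  leaf-ratio : ∀ q cw cp s → s ≡ 0ℤ → (1ℤ + q) * cw - cp - s ≡ 0ℤ → cp * 1ℤ ≡ cw * (1ℤ + 1ℤ * q)
  leaf-ratio q cw cp .0ℤ refl harmonic = begin
    cp * 1ℤ                                              ≡⟨ rearrange q cw cp ⟩
    cw * (1ℤ + 1ℤ * q) - ((1ℤ + q) * cw - cp - 0ℤ)      ≡⟨ cong (_-_ (cw * (1ℤ + 1ℤ * q))) harmonic ⟩
    cw * (1ℤ + 1ℤ * q) - 0ℤ                              ≡⟨ +-identityʳ _ ⟩
    cw * (1ℤ + 1ℤ * q)                                   ∎
    where
    rearrange : ∀ q cw cp → cp * 1ℤ ≡ cw * (1ℤ + 1ℤ * q) - ((1ℤ + q) * cw - cp - 0ℤ)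
    rearrange = solve-∀

  internal-ratio : ∀ q x cw cp s → (1ℤ + q) * cw - cp - s ≡ 0ℤ → (1ℤ + x * q) * s ≡ q * (cw * x) →
                   cp * (1ℤ + x * q) ≡ cw * (1ℤ + (1ℤ + x * q) * q)
  internal-ratio q x cw cp s harmonic children = begin
    cp * (1ℤ + x * q)
      ≡⟨ rearrange q x cw cp s ⟩
    (1ℤ + q) * cw * (1ℤ + x * q) - (1ℤ + x * q) * s - ((1ℤ + q) * cw - cp - s) * (1ℤ + x * q)
      ≡⟨ cong₂ (λ a b → (1ℤ + q) * cw * (1ℤ + x * q) - a - b * (1ℤ + x * q)) children harmonic ⟩
    (1ℤ + q) * cw * (1ℤ + x * q) - q * (cw * x) - 0ℤ * (1ℤ + x * q)
      ≡⟨ simplify q x cw ⟩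
    cw * (1ℤ + (1ℤ + x * q) * q) ∎
    where
    rearrange : ∀ q x cw cp s → cp * (1ℤ + x * q)
      ≡ (1ℤ + q) * cw * (1ℤ + x * q) - (1ℤ + x * q) * s - ((1ℤ + q) * cw - cp - s) * (1ℤ + x * q)
    rearrange = solve-∀
    simplify : ∀ q x cw → (1ℤ + q) * cw * (1ℤ + x * q) - q * (cw * x) - 0ℤ * (1ℤ + x * q)
                          ≡ cw * (1ℤ + (1ℤ + x * q) * q)
    simplify = solve-∀

  root-ratio : ∀ δ c s x p → δ * c - 0ℤ - s ≡ 0ℤ → (x + p) * s ≡ δ * (c * x) → c * (δ * p) ≡ 0ℤ
  root-ratio δ c s x p harmonic children = begin
    c * (δ * p)                                               ≡⟨ rearrange δ c s x p ⟩
    (x + p) * (δ * c - 0ℤ - s) + ((x + p) * s - δ * (c * x))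
      ≡⟨ cong₂ (λ a b → (x + p) * a + (b - δ * (c * x))) harmonic children ⟩
    (x + p) * 0ℤ + (δ * (c * x) - δ * (c * x))                ≡⟨ cancel (x + p) (δ * (c * x)) ⟩
    0ℤ                                                        ∎
    where
    rearrange : ∀ δ c s x p → c * (δ * p) ≡ (x + p) * (δ * c - 0ℤ - s) + ((x + p) * s - δ * (c * x))
    rearrange = solve-∀
    cancel : ∀ a b → a * 0ℤ + (b - b) ≡ 0ℤ
    cancel = solve-∀

  -- Going up from the leaves, a harmonic c satisfies c(parent w)·θ(r+1) = c(w)·θ(r+2) at every vertex w
  -- of height r; at the root this leaves c(root)·d·qʰ = 0.
  module _ (c : V → ℤ) (harmonic : ∀ w → combo c w ≡ 0ℤ) where

    parent-ratio : ∀ r {n} (p : suc n ℕ.≤ h) → h ∸ suc n ≡ r → (w : Node d (suc n)) →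
      c (n , ≤-trans (n≤1+n n) p , parent w) * Θ (1 ℕ.+ r) ≡ c (suc n , p , w) * Θ (2 ℕ.+ r)
    parent-ratio zero    {n} p height w =
      leaf-ratio (+ q) (c (suc n , p , w)) _ (childTerm c (suc n) w) (childTerm-leaf c w (height-zero⇒leaf height)) (harmonic (suc n , p , w))
    parent-ratio (suc r) {n} p height w =
      internal-ratio (+ q) (Θ (1 ℕ.+ r)) (c (suc n , p , w)) _ (childTerm c (suc n) w) (harmonic (suc n , p , w))
        (trans (cong (Θ (2 ℕ.+ r) *_) (childTerm-internal c w p′))
               (childrenSum-proportional w (λ u → c (suc (suc n) , p′ , u)) (c (suc n , p , w))
                                         (Θ (1 ℕ.+ r)) (Θ (2 ℕ.+ r)) children-ratio))
      where
      p′ : suc (suc n) ℕ.≤ h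
      p′ = height-suc⇒internal height

      children-ratio : ∀ u → parent u ≡ w →
        c (suc n , p , w) * Θ (1 ℕ.+ r) ≡ c (suc (suc n) , p′ , u) * Θ (2 ℕ.+ r)
      children-ratio u u∈w = begin
        c (suc n , p , w) * Θ (1 ℕ.+ r)        ≡⟨ cong (λ v → c (suc n , p , v) * Θ (1 ℕ.+ r)) u∈w ⟨
        c (suc n , p , parent u) * Θ (1 ℕ.+ r) ≡⟨ cong (_* Θ (1 ℕ.+ r)) (value-irrelevant c p _ (parent u)) ⟩
        _                                      ≡⟨ parent-ratio r p′ (ℕ.suc-injective (trans (sym (height-suc p′)) height)) u ⟩
        c (suc (suc n) , p′ , u) * Θ (2 ℕ.+ r) ∎

    root-zero : ∀ p → c (0 , p , root) ≡ 0ℤ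
    root-zero p = *-nonZero≡0⇒≡0 (c (0 , p , root)) (+ (d ℕ.* q ^ h)) {{ℕ.m*n≢0 d (q ^ h) {{_}} {{ℕ.m^n≢0 q h}}}}
      (begin
        c (0 , p , root) * + (d ℕ.* q ^ h)   ≡⟨ cong (c (0 , p , root) *_) (pos-* d (q ^ h)) ⟩
        c (0 , p , root) * (+ d * + (q ^ h))
          ≡⟨ root-ratio (+ d) (c (0 , p , root)) (childTerm c 0 root) (Θ h) (+ (q ^ h)) (harmonic (0 , p , root)) children ⟩
        0ℤ                                   ∎)
      where
      children : (Θ h + + (q ^ h)) * childTerm c 0 root ≡ + d * (c (0 , p , root) * Θ h)
      children = begin
        (Θ h + + (q ^ h)) * childTerm c 0 root
          ≡⟨ cong₂ _*_ (Θ-suc≡Θ+pow h) (childTerm-internal c root (s≤s z≤n)) ⟨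
        Θ (suc h) * childrenSum root (λ u → c (1 , s≤s z≤n , u))
          ≡⟨ childrenSum-proportional root (λ u → c (1 , s≤s z≤n , u)) (c (0 , p , root)) (Θ h) (Θ (suc h))
               (λ { (top i) _ → trans (cong (_* Θ h) (value-irrelevant c p _ root)) (parent-ratio h′ (s≤s z≤n) refl (top i)) }) ⟩
        + d * (c (0 , p , root) * Θ h) ∎

    zero-at-depth : ∀ n (p : n ℕ.≤ h) v → c (n , p , v) ≡ 0ℤ
    zero-at-depth zero    p root = root-zero p
    zero-at-depth (suc n) p v    =
      *-nonZero≡0⇒≡0 (c (suc n , p , v)) (Θ (2 ℕ.+ r)) {{Θ-suc-nonZero (suc r)}} (begin
        c (suc n , p , v) * Θ (2 ℕ.+ r)     ≡⟨ parent-ratio r p refl v ⟨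
        c (n , _ , parent v) * Θ (1 ℕ.+ r)  ≡⟨ cong (_* Θ (1 ℕ.+ r)) (zero-at-depth n _ (parent v)) ⟩
        0ℤ * Θ (1 ℕ.+ r)                    ≡⟨ *-zeroˡ (Θ (1 ℕ.+ r)) ⟩
        0ℤ                                  ∎)
      where
      r : ℕ
      r = h ∸ suc n

  harmonic⇒zero : (c : V → ℤ) → (∀ w → combo c w ≡ 0ℤ) → ∀ w → c w ≡ 0ℤ
  harmonic⇒zero c harmonic (n , p , v) = zero-at-depth c harmonic n p v

module Green (k h′ : ℕ) where

  open import Data.Fin as Fin using (Fin)
  open import Data.Nat as ℕ using (zero; suc; _∸_; _<_; _^_; s≤s; z≤n)
  open import Data.Nat.Properties as ℕ using (≤-trans; n≤1+n)
  open import Data.Nat.Divisibility as ∣ using (_∣_)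
  open import Data.Nat.DivMod using (_/_; m/n*n≡m)
  open import Data.Nat.Coprimality as Coprime using (coprime-divisor)
  import Data.Nat.Tactic.RingSolver as NatSolver
  open import Data.Integer using (ℤ; +_; _+_; _-_; _*_; 0ℤ; 1ℤ; ∣_∣)
  import Data.Integer as ℤ
  open import Data.Integer.Properties using (pos-*; *-identityˡ; +-identityʳ; *-zeroʳ; *-assoc)
  open import Data.Integer.Divisibility.Signed using (∣⇒∣ᵤ) renaming (_∣_ to _ℤ∣_)
  open import Data.Integer.Tactic.RingSolver using (solve-∀)
  open import Data.Product using (Σ; _,_)
  open import Relation.Nullary using (Dec; yes; no; contradiction)
  open import Relation.Binary.PropositionalEquality
  open ≡-Reasoning
  open FinSums using (sumFin-const)
  open Repunits using (repunit; repunit-coprime-suc)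
  open Repunits.ExponentFormula k h′ using (rootModulus)
  open Tree k h′

  root-identity : ∀ δ x p κ K y s xs → xs ≡ x + p → x * κ ≡ K * (δ * p) →
    δ * (xs * (K * (xs * y + s))) - 0ℤ - (δ * (x * (K * (xs * y + s))) + x * κ * s) ≡ K * (δ * p * xs) * y
  root-identity δ x p κ K y s .(x + p) refl xκ≡ = begin
    δ * ((x + p) * (K * ((x + p) * y + s))) - 0ℤ - (δ * (x * (K * ((x + p) * y + s))) + x * κ * s)
      ≡⟨ rearrange δ x p κ K y s ⟩
    K * (δ * p) * ((x + p) * y + s) - x * κ * s
      ≡⟨ cong (λ t → K * (δ * p) * ((x + p) * y + s) - t * s) xκ≡ ⟩
    K * (δ * p) * ((x + p) * y + s) - K * (δ * p) * s
      ≡⟨ simplify δ x p K y s ⟩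
    K * (δ * p * (x + p)) * y ∎
    where
    rearrange : ∀ δ x p κ K y s →
      δ * ((x + p) * (K * ((x + p) * y + s))) - 0ℤ - (δ * (x * (K * ((x + p) * y + s))) + x * κ * s)
      ≡ K * (δ * p) * ((x + p) * y + s) - x * κ * s
    rearrange = solve-∀
    simplify : ∀ δ x p K y s → K * (δ * p) * ((x + p) * y + s) - K * (δ * p) * s ≡ K * (δ * p * (x + p)) * y
    simplify = solve-∀

  internal-identity : ∀ q x κ κ′ t y s → x * κ ≡ (1ℤ + (1ℤ + x * q) * q) * κ′ →
    (1ℤ + q) * ((1ℤ + x * q) * (t + κ′ * ((1ℤ + x * q) * y + s))) - (1ℤ + (1ℤ + x * q) * q) * t
      - (q * (x * (t + κ′ * ((1ℤ + x * q) * y + s))) + x * κ * s)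
    ≡ x * κ * ((1ℤ + x * q) * y)
  internal-identity q x κ κ′ t y s step = begin
    (1ℤ + q) * ((1ℤ + x * q) * (t + κ′ * ((1ℤ + x * q) * y + s))) - (1ℤ + (1ℤ + x * q) * q) * t
      - (q * (x * (t + κ′ * ((1ℤ + x * q) * y + s))) + x * κ * s)
      ≡⟨ rearrange q x κ κ′ t y s ⟩
    (1ℤ + (1ℤ + x * q) * q) * κ′ * ((1ℤ + x * q) * y + s) - x * κ * s
      ≡⟨ cong (λ c → c * ((1ℤ + x * q) * y + s) - x * κ * s) step ⟨
    x * κ * ((1ℤ + x * q) * y + s) - x * κ * s
      ≡⟨ simplify (x * κ) ((1ℤ + x * q) * y) s ⟩
    x * κ * ((1ℤ + x * q) * y) ∎
    where
    rearrange : ∀ q x κ κ′ t y s →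
      (1ℤ + q) * ((1ℤ + x * q) * (t + κ′ * ((1ℤ + x * q) * y + s))) - (1ℤ + (1ℤ + x * q) * q) * t
        - (q * (x * (t + κ′ * ((1ℤ + x * q) * y + s))) + x * κ * s)
      ≡ (1ℤ + (1ℤ + x * q) * q) * κ′ * ((1ℤ + x * q) * y + s) - x * κ * s
    rearrange = solve-∀
    simplify : ∀ a b s → a * (b + s) - a * s ≡ a * b
    simplify = solve-∀

  leaf-identity : ∀ q t κ y → (1ℤ + q) * (1ℤ * (t + κ * y)) - (1ℤ + 1ℤ * q) * t - 0ℤ ≡ 1ℤ * κ * ((1ℤ + 1ℤ * q) * y)
  leaf-identity = solve-∀

  module ScaledInverse (e : ℕ) (rootModulus∣e : rootModulus ∣ e)
                       (pair∣e : ∀ a → a < h → repunit q (suc a) ℕ.* repunit q (2 ℕ.+ a) ∣ e) where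

    K : ℕ
    K = _∣_.quotient rootModulus∣e

    pairQuotient : ℕ → ℕ
    pairQuotient a = e / (repunit q (suc a) ℕ.* repunit q (2 ℕ.+ a))

    e≡pairQuotient* : ∀ a → a < h → e ≡ repunit q (suc a) ℕ.* pairQuotient a ℕ.* repunit q (2 ℕ.+ a)
    e≡pairQuotient* a a<h = trans (sym (m/n*n≡m (pair∣e a a<h))) (rearrange (pairQuotient a) (repunit q (suc a)) (repunit q (2 ℕ.+ a)))
      where
      rearrange : ∀ x y z → x ℕ.* (y ℕ.* z) ≡ y ℕ.* x ℕ.* z
      rearrange = NatSolver.solve-∀

    pairQuotient-step : ∀ a → suc a < h →
      repunit q (suc a) ℕ.* pairQuotient a ≡ repunit q (3 ℕ.+ a) ℕ.* pairQuotient (suc a)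
    pairQuotient-step a 1+a<h =
      ℕ.*-cancelʳ-≡ (repunit q (suc a) ℕ.* pairQuotient a) (repunit q (3 ℕ.+ a) ℕ.* pairQuotient (suc a)) (repunit q (2 ℕ.+ a)) (begin
      repunit q (suc a) ℕ.* pairQuotient a ℕ.* repunit q (2 ℕ.+ a)
        ≡⟨ e≡pairQuotient* a (ℕ.<-trans (ℕ.n<1+n a) 1+a<h) ⟨
      e ≡⟨ e≡pairQuotient* (suc a) 1+a<h ⟩
      repunit q (2 ℕ.+ a) ℕ.* pairQuotient (suc a) ℕ.* repunit q (3 ℕ.+ a)
        ≡⟨ rearrange (repunit q (2 ℕ.+ a)) (pairQuotient (suc a)) (repunit q (3 ℕ.+ a)) ⟩
      repunit q (3 ℕ.+ a) ℕ.* pairQuotient (suc a) ℕ.* repunit q (2 ℕ.+ a) ∎)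
      where
      rearrange : ∀ x y z → x ℕ.* y ℕ.* z ≡ z ℕ.* y ℕ.* x
      rearrange = NatSolver.solve-∀

    pairQuotient-top : repunit q h ℕ.* pairQuotient h′ ≡ K ℕ.* (d ℕ.* q ^ h)
    pairQuotient-top = ℕ.*-cancelʳ-≡ (repunit q h ℕ.* pairQuotient h′) (K ℕ.* (d ℕ.* q ^ h)) (repunit q (suc h)) (begin
      repunit q h ℕ.* pairQuotient h′ ℕ.* repunit q (suc h)  ≡⟨ e≡pairQuotient* h′ ℕ.≤-refl ⟨
      e                                                       ≡⟨ _∣_.equality rootModulus∣e ⟩
      K ℕ.* (d ℕ.* q ^ h ℕ.* repunit q (suc h))               ≡⟨ ℕ.*-assoc K (d ℕ.* q ^ h) (repunit q (suc h)) ⟨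
      K ℕ.* (d ℕ.* q ^ h) ℕ.* repunit q (suc h)               ∎)

    Θ*+≡+ : ∀ n m → Θ n * + m ≡ + (repunit q n ℕ.* m)
    Θ*+≡+ n m = trans (cong (_* + m) (sym (+repunit≡Θ n))) (sym (pos-* (repunit q n) m))

    e≡pairQuotient*ℤ : ∀ a → a < h → + e ≡ Θ (suc a) * + pairQuotient a * Θ (2 ℕ.+ a)
    e≡pairQuotient*ℤ a a<h = begin
      + e                                                                   ≡⟨ cong +_ (e≡pairQuotient* a a<h) ⟩
      + (repunit q (suc a) ℕ.* pairQuotient a ℕ.* repunit q (2 ℕ.+ a))
        ≡⟨ pos-* (repunit q (suc a) ℕ.* pairQuotient a) (repunit q (2 ℕ.+ a)) ⟩
      + (repunit q (suc a) ℕ.* pairQuotient a) * + repunit q (2 ℕ.+ a)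
        ≡⟨ cong₂ _*_ (sym (Θ*+≡+ (suc a) (pairQuotient a))) (+repunit≡Θ (2 ℕ.+ a)) ⟩
      Θ (suc a) * + pairQuotient a * Θ (2 ℕ.+ a)                            ∎

    pairQuotient-stepℤ : ∀ a → suc a < h → Θ (suc a) * + pairQuotient a ≡ Θ (3 ℕ.+ a) * + pairQuotient (suc a)
    pairQuotient-stepℤ a 1+a<h = trans (Θ*+≡+ (suc a) (pairQuotient a))
      (trans (cong +_ (pairQuotient-step a 1+a<h)) (sym (Θ*+≡+ (3 ℕ.+ a) (pairQuotient (suc a)))))

    pairQuotient-topℤ : Θ h * + pairQuotient h′ ≡ + K * (+ d * + (q ^ h))
    pairQuotient-topℤ = begin
      Θ h * + pairQuotient h′   ≡⟨ Θ*+≡+ h (pairQuotient h′) ⟩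
      + (repunit q h ℕ.* pairQuotient h′) ≡⟨ cong +_ pairQuotient-top ⟩
      + (K ℕ.* (d ℕ.* q ^ h))   ≡⟨ pos-* K (d ℕ.* q ^ h) ⟩
      + K * + (d ℕ.* q ^ h)     ≡⟨ cong (+ K *_) (pos-* d (q ^ h)) ⟩
      + K * (+ d * + (q ^ h))   ∎

    e≡K*rootModulusℤ : + e ≡ + K * (+ d * + (q ^ h) * Θ (suc h))
    e≡K*rootModulusℤ = begin
      + e                                          ≡⟨ cong +_ (_∣_.equality rootModulus∣e) ⟩
      + (K ℕ.* (d ℕ.* q ^ h ℕ.* repunit q (suc h))) ≡⟨ pos-* K (d ℕ.* q ^ h ℕ.* repunit q (suc h)) ⟩
      + K * + (d ℕ.* q ^ h ℕ.* repunit q (suc h))   ≡⟨ cong (+ K *_) (pos-* (d ℕ.* q ^ h) (repunit q (suc h))) ⟩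
      + K * (+ (d ℕ.* q ^ h) * + repunit q (suc h)) ≡⟨ cong₂ (λ x y → + K * (x * y)) (pos-* d (q ^ h)) (+repunit≡Θ (suc h)) ⟩
      + K * (+ d * + (q ^ h) * Θ (suc h))           ∎

    pair-scaling : ∀ a → a < h → ∀ y → Θ (suc a) * + pairQuotient a * (Θ (2 ℕ.+ a) * y) ≡ + e * y
    pair-scaling a a<h y = trans (sym (*-assoc (Θ (suc a) * + pairQuotient a) (Θ (2 ℕ.+ a)) y))
                                 (cong (_* y) (sym (e≡pairQuotient*ℤ a a<h)))

    -- subtreeLoad r n v = Σ θ(r+1-j)·Y(u) over the descendants u of v at distance j ≤ r. At a vertex of
    -- height r, green = θ(r+1)·potential, and the potential adds up K·subtreeLoad h root and, for each
    -- non-root u of height r′ on the path from the root, pairQuotient r′·subtreeLoad r′ u. The identity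
    -- θ(r+1)·pairQuotient r = θ(r+3)·pairQuotient (r+1), both being e/θ(r+2), makes L green = e·Y.
    module _ (Y : (n : ℕ) → Node d n → ℤ) where

      subtreeLoad : ℕ → (n : ℕ) → Node d n → ℤ
      subtreeLoad zero    n v = Y n v
      subtreeLoad (suc r) n v = Θ (2 ℕ.+ r) * Y n v + childrenSum v (subtreeLoad r (suc n))

      potential : (n : ℕ) → Node d n → ℤ
      potential zero    root = + K * subtreeLoad h 0 root
      potential (suc n) v    =
        potential n (parent v) + + pairQuotient (h ∸ suc n) * subtreeLoad (h ∸ suc n) (suc n) v

      green : V → ℤ
      green (n , _ , v) = Θ (suc (h ∸ n)) * potential n v

      green-at : ∀ {n r} (p : n ℕ.≤ h) v → h ∸ n ≡ r → green (n , p , v) ≡ Θ (suc r) * potential n v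
      green-at p v refl = refl

      potential-suc : ∀ {n a} (v : Node d (suc n)) → h ∸ suc n ≡ a →
        potential (suc n) v ≡ potential n (parent v) + + pairQuotient a * subtreeLoad a (suc n) v
      potential-suc v refl = refl

      childTerm-green : ∀ {n a} (v : Node d n) → suc n ℕ.≤ h → h ∸ suc n ≡ a →
        childTerm green n v ≡ + arity n * (Θ (suc a) * potential n v)
                              + Θ (suc a) * + pairQuotient a * childrenSum v (subtreeLoad a (suc n))
      childTerm-green {n} {a} v p height = begin
        childTerm green n v
          ≡⟨ childTerm-internal green v p ⟩
        childrenSum v (λ u → green (suc n , p , u))
          ≡⟨ childrenSum-cong v child ⟩
        childrenSum v (λ u → Θ (suc a) * potential n v + Θ (suc a) * + pairQuotient a * subtreeLoad a (suc n) u)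
          ≡⟨ childrenSum-affine v _ (Θ (suc a) * + pairQuotient a) (subtreeLoad a (suc n)) ⟩
        + arity n * (Θ (suc a) * potential n v) + Θ (suc a) * + pairQuotient a * childrenSum v (subtreeLoad a (suc n)) ∎
        where
        distrib : ∀ x t κ s → x * (t + κ * s) ≡ x * t + x * κ * s
        distrib = solve-∀

        child : ∀ u → parent u ≡ v →
          green (suc n , p , u) ≡ Θ (suc a) * potential n v + Θ (suc a) * + pairQuotient a * subtreeLoad a (suc n) u
        child u u∈v = begin
          green (suc n , p , u)
            ≡⟨ green-at p u height ⟩
          Θ (suc a) * potential (suc n) u
            ≡⟨ cong (Θ (suc a) *_) (potential-suc u height) ⟩
          Θ (suc a) * (potential n (parent u) + + pairQuotient a * subtreeLoad a (suc n) u)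
            ≡⟨ cong (λ w → Θ (suc a) * (potential n w + + pairQuotient a * subtreeLoad a (suc n) u)) u∈v ⟩
          Θ (suc a) * (potential n v + + pairQuotient a * subtreeLoad a (suc n) u)
            ≡⟨ distrib (Θ (suc a)) (potential n v) (+ pairQuotient a) (subtreeLoad a (suc n) u) ⟩
          Θ (suc a) * potential n v + Θ (suc a) * + pairQuotient a * subtreeLoad a (suc n) u ∎

      green-root : ∀ p → combo green (0 , p , root) ≡ + e * Y 0 root
      green-root p = begin
        + d * (Θ (suc h) * (+ K * (Θ (suc h) * Y 0 root + σ))) - 0ℤ - childTerm green 0 root
          ≡⟨ cong (+ d * (Θ (suc h) * (+ K * (Θ (suc h) * Y 0 root + σ))) - 0ℤ -_) (childTerm-green root (s≤s z≤n) refl) ⟩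
        + d * (Θ (suc h) * (+ K * (Θ (suc h) * Y 0 root + σ))) - 0ℤ
          - (+ d * (Θ h * (+ K * (Θ (suc h) * Y 0 root + σ))) + Θ h * + pairQuotient h′ * σ)
          ≡⟨ root-identity (+ d) (Θ h) (+ (q ^ h)) (+ pairQuotient h′) (+ K) (Y 0 root) σ (Θ (suc h))
                           (Θ-suc≡Θ+pow h) pairQuotient-topℤ ⟩
        + K * (+ d * + (q ^ h) * Θ (suc h)) * Y 0 root
          ≡⟨ cong (_* Y 0 root) e≡K*rootModulusℤ ⟨
        + e * Y 0 root ∎
        where
        σ : ℤ
        σ = childrenSum root (subtreeLoad h′ 1)

      green-leaf : ∀ {n} (p : suc n ℕ.≤ h) w → h ∸ suc n ≡ 0 → combo green (suc n , p , w) ≡ + e * Y (suc n) w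
      green-leaf {n} p w height = begin
        + d * green (suc n , p , w) - green (n , p₀ , parent w) - childTerm green (suc n) w
          ≡⟨ cong₂ (λ g c → + d * g - green (n , p₀ , parent w) - c)
                   (green-at p w height) (childTerm-leaf green w (height-zero⇒leaf height)) ⟩
        + d * (Θ 1 * potential (suc n) w) - green (n , p₀ , parent w) - 0ℤ
          ≡⟨ cong₂ (λ t g → + d * (Θ 1 * t) - g - 0ℤ)
                   (potential-suc w height) (green-at p₀ (parent w) (trans (height-suc p) (cong suc height))) ⟩
        + d * (Θ 1 * (t + + pairQuotient 0 * Y (suc n) w)) - Θ 2 * t - 0ℤ
          ≡⟨ leaf-identity (+ q) t (+ pairQuotient 0) (Y (suc n) w) ⟩
        Θ 1 * + pairQuotient 0 * (Θ 2 * Y (suc n) w)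
          ≡⟨ pair-scaling 0 (s≤s z≤n) (Y (suc n) w) ⟩
        + e * Y (suc n) w ∎
        where
        p₀ : n ℕ.≤ h
        p₀ = ≤-trans (n≤1+n n) p
        t : ℤ
        t = potential n (parent w)

      green-internal : ∀ {n a} (p : suc n ℕ.≤ h) w → h ∸ suc n ≡ suc a →
                       combo green (suc n , p , w) ≡ + e * Y (suc n) w
      green-internal {n} {a} p w height = begin
        + d * green (suc n , p , w) - green (n , p₀ , parent w) - childTerm green (suc n) w
          ≡⟨ cong₂ (λ g c → + d * g - green (n , p₀ , parent w) - c) (green-at p w height) (childTerm-green w p′ height′) ⟩
        + d * (Θ (2 ℕ.+ a) * potential (suc n) w) - green (n , p₀ , parent w)
          - (+ q * (Θ (suc a) * potential (suc n) w) + Θ (suc a) * + pairQuotient a * σ)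
          ≡⟨ cong₂ (λ T g → + d * (Θ (2 ℕ.+ a) * T) - g - (+ q * (Θ (suc a) * T) + Θ (suc a) * + pairQuotient a * σ))
                   (potential-suc w height) (green-at p₀ (parent w) (trans (height-suc p) (cong suc height))) ⟩
        + d * (Θ (2 ℕ.+ a) * (t + + pairQuotient (suc a) * (Θ (2 ℕ.+ a) * Y (suc n) w + σ))) - Θ (3 ℕ.+ a) * t
          - (+ q * (Θ (suc a) * (t + + pairQuotient (suc a) * (Θ (2 ℕ.+ a) * Y (suc n) w + σ))) + Θ (suc a) * + pairQuotient a * σ)
          ≡⟨ internal-identity (+ q) (Θ (suc a)) (+ pairQuotient a) (+ pairQuotient (suc a)) t (Y (suc n) w) σ
                               (pairQuotient-stepℤ a (height< {n} height)) ⟩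
        Θ (suc a) * + pairQuotient a * (Θ (2 ℕ.+ a) * Y (suc n) w)
          ≡⟨ pair-scaling a (ℕ.<-trans (ℕ.n<1+n a) (height< {n} height)) (Y (suc n) w) ⟩
        + e * Y (suc n) w ∎
        where
        p₀ : n ℕ.≤ h
        p₀ = ≤-trans (n≤1+n n) p
        p′ : suc (suc n) ℕ.≤ h
        p′ = height-suc⇒internal height
        height′ : h ∸ suc (suc n) ≡ a
        height′ = ℕ.suc-injective (trans (sym (height-suc p′)) height)
        t : ℤ
        t = potential n (parent w)
        σ : ℤ
        σ = childrenSum w (subtreeLoad a (2 ℕ.+ n))

      green-solves : ∀ w → combo green w ≡ + e * atVertices Y w
      green-solves (zero  , p , root) = green-root p
      green-solves (suc n , p , w) = below (h ∸ suc n) refl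
        where
        below : ∀ r → h ∸ suc n ≡ r → combo green (suc n , p , w) ≡ + e * Y (suc n) w
        below zero    height = green-leaf p w height
        below (suc a) height = green-internal p w height

      subtreeLoad-deep : ∀ n₀ → (∀ n → n₀ ℕ.≤ n → ∀ v → Y n v ≡ 0ℤ) →
                         ∀ r n → n₀ ℕ.≤ n → ∀ v → subtreeLoad r n v ≡ 0ℤ
      subtreeLoad-deep n₀ vanish zero    n n₀≤n v = vanish n n₀≤n v
      subtreeLoad-deep n₀ vanish (suc r) n n₀≤n v = begin
        Θ (2 ℕ.+ r) * Y n v + childrenSum v (subtreeLoad r (suc n))
          ≡⟨ cong₂ (λ y s → Θ (2 ℕ.+ r) * y + s) (vanish n n₀≤n v)
                   (childrenSum-zero v (λ u → subtreeLoad-deep n₀ vanish r (suc n) (ℕ.m≤n⇒m≤1+n n₀≤n) u)) ⟩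
        Θ (2 ℕ.+ r) * 0ℤ + 0ℤ
          ≡⟨ cong (_+ 0ℤ) (*-zeroʳ (Θ (2 ℕ.+ r))) ⟩
        0ℤ ∎

      subtreeLoad-bottom : ∀ n → (∀ n′ → suc n ℕ.≤ n′ → ∀ v → Y n′ v ≡ 0ℤ) →
                           ∀ r v → subtreeLoad r n v ≡ Θ (suc r) * Y n v
      subtreeLoad-bottom n vanish zero    v = sym (*-identityˡ (Y n v))
      subtreeLoad-bottom n vanish (suc r) v = begin
        Θ (2 ℕ.+ r) * Y n v + childrenSum v (subtreeLoad r (suc n))
          ≡⟨ cong (_+_ (Θ (2 ℕ.+ r) * Y n v))
                  (childrenSum-zero v (subtreeLoad-deep (suc n) vanish r (suc n) ℕ.≤-refl)) ⟩
        Θ (2 ℕ.+ r) * Y n v + 0ℤ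
          ≡⟨ +-identityʳ _ ⟩
        Θ (2 ℕ.+ r) * Y n v ∎

    -- Chosen so that subtreeLoad h root = θₕ₊₁ − q·θₕ = 1, which makes green equal to K at the leaves below top 1.
    rootLoad : (n : ℕ) → Node d n → ℤ
    rootLoad zero          root              = 1ℤ
    rootLoad (suc zero)    (top Fin.zero)    = ℤ.- + q
    rootLoad (suc zero)    (top (Fin.suc _)) = 0ℤ
    rootLoad (suc (suc n)) _                 = 0ℤ

    rootLoad-deep : ∀ n → 2 ℕ.≤ n → ∀ v → rootLoad n v ≡ 0ℤ
    rootLoad-deep (suc (suc n)) _         v = refl
    rootLoad-deep (suc zero)    (s≤s ()) v

    subtreeLoad-rootLoad : subtreeLoad rootLoad h 0 root ≡ 1ℤ
    subtreeLoad-rootLoad = begin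
      Θ (suc h) * 1ℤ + childrenSum root (subtreeLoad rootLoad h′ 1)
        ≡⟨ cong (_+_ (Θ (suc h) * 1ℤ)) (childrenSum-cong root (λ u _ → subtreeLoad-bottom rootLoad 1 rootLoad-deep h′ u)) ⟩
      Θ (suc h) * 1ℤ + (Θ h * ℤ.- + q + sumFin (2 ℕ.+ k) (λ _ → Θ h * 0ℤ))
        ≡⟨ cong (λ s → Θ (suc h) * 1ℤ + (Θ h * ℤ.- + q + s)) (sumFin-const (2 ℕ.+ k) (Θ h * 0ℤ)) ⟩
      (1ℤ + Θ h * + q) * 1ℤ + (Θ h * ℤ.- + q + + (2 ℕ.+ k) * (Θ h * 0ℤ))
        ≡⟨ cancel (Θ h) (+ q) (+ (2 ℕ.+ k)) ⟩
      1ℤ ∎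
      where
      cancel : ∀ x q c → (1ℤ + x * q) * 1ℤ + (x * ℤ.- q + c * (x * 0ℤ)) ≡ 1ℤ
      cancel = solve-∀

    branchSign : ∀ {m} → Fin m → ℤ
    branchSign Fin.zero                = 1ℤ
    branchSign (Fin.suc Fin.zero)      = ℤ.- 1ℤ
    branchSign (Fin.suc (Fin.suc _))   = 0ℤ

    lastBranchSign : ∀ {n} → Node d (suc n) → ℤ
    lastBranchSign (top i)   = branchSign i
    lastBranchSign (ext _ i) = branchSign i

    spine : Fin d → ∀ n → Node d (suc n)
    spine i zero    = top i
    spine i (suc n) = ext (spine i n) Fin.zero

    sideLeaf : ∀ n → Node d (suc n)
    sideLeaf = spine (Fin.suc Fin.zero)

    lastBranchSign-spine : ∀ n → lastBranchSign (spine Fin.zero n) ≡ 1ℤ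
    lastBranchSign-spine zero    = refl
    lastBranchSign-spine (suc n) = refl

    potential-sideLeaf : ∀ n → potential rootLoad (suc n) (sideLeaf n) ≡ + K
    potential-sideLeaf zero = begin
      + K * subtreeLoad rootLoad h 0 root + + pairQuotient h′ * subtreeLoad rootLoad h′ 1 (top (Fin.suc Fin.zero))
        ≡⟨ cong₂ (λ s t → + K * s + + pairQuotient h′ * t) subtreeLoad-rootLoad
                 (subtreeLoad-bottom rootLoad 1 rootLoad-deep h′ (top (Fin.suc Fin.zero))) ⟩
      + K * 1ℤ + + pairQuotient h′ * (Θ h * 0ℤ)
        ≡⟨ simplify (+ K) (+ pairQuotient h′) (Θ h) ⟩
      + K ∎
      where
      simplify : ∀ a b c → a * 1ℤ + b * (c * 0ℤ) ≡ a
      simplify = solve-∀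
    potential-sideLeaf (suc n) = begin
      potential rootLoad (suc n) (sideLeaf n) + + pairQuotient r * subtreeLoad rootLoad r (2 ℕ.+ n) (sideLeaf (suc n))
        ≡⟨ cong₂ (λ t s → t + + pairQuotient r * s) (potential-sideLeaf n)
                 (subtreeLoad-deep rootLoad 2 rootLoad-deep r (2 ℕ.+ n) (s≤s (s≤s z≤n)) (sideLeaf (suc n))) ⟩
      + K + + pairQuotient r * 0ℤ
        ≡⟨ simplify (+ K) (+ pairQuotient r) ⟩
      + K ∎
      where
      r : ℕ
      r = h ∸ suc (suc n)
      simplify : ∀ a b → a + b * 0ℤ ≡ a
      simplify = solve-∀

    green-sideLeaf : green rootLoad (h , ℕ.≤-refl , sideLeaf h′) ≡ + K
    green-sideLeaf = begin
      green rootLoad (h , ℕ.≤-refl , sideLeaf h′)    ≡⟨ green-at rootLoad ℕ.≤-refl (sideLeaf h′) (ℕ.n∸n≡0 h) ⟩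
      1ℤ * potential rootLoad h (sideLeaf h′)        ≡⟨ *-identityˡ _ ⟩
      potential rootLoad h (sideLeaf h′)             ≡⟨ potential-sideLeaf h′ ⟩
      + K                                            ∎

    sumFin-branchSign : ∀ m → sumFin (2 ℕ.+ m) branchSign ≡ 0ℤ
    sumFin-branchSign m = trans (cong (λ s → 1ℤ + (ℤ.- 1ℤ + s)) (sumFin-const m 0ℤ)) (cancel (+ m))
      where
      cancel : ∀ c → 1ℤ + (ℤ.- 1ℤ + c * 0ℤ) ≡ 0ℤ
      cancel = solve-∀

    childrenSum-lastBranchSign : ∀ {n} (v : Node d n) → childrenSum v lastBranchSign ≡ 0ℤ
    childrenSum-lastBranchSign {zero}  root = sumFin-branchSign (suc k)
    childrenSum-lastBranchSign {suc n} v    = sumFin-branchSign k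

    -- +1 and −1 on the first two children of every vertex of depth j, so that only the subtree sums of
    -- those children are nonzero.
    pairLoad : ℕ → (n : ℕ) → Node d n → ℤ
    pairLoad j zero    v = 0ℤ
    pairLoad j (suc n) v with n ℕ.≟ j
    ... | yes _ = lastBranchSign v
    ... | no  _ = 0ℤ

    module PairLoad (a : ℕ) (a≤h′ : a ℕ.≤ h′) where

      j : ℕ
      j = h′ ∸ a

      Y : (n : ℕ) → Node d n → ℤ
      Y = pairLoad j

      pairLoad-on : ∀ v → Y (suc j) v ≡ lastBranchSign v
      pairLoad-on v with j ℕ.≟ j
      ... | yes _   = refl
      ... | no  j≢j = contradiction refl j≢j

      pairLoad-off : ∀ {n} v → n ≢ j → Y (suc n) v ≡ 0ℤ
      pairLoad-off {n} v n≢j with n ℕ.≟ j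
      ... | yes n≡j = contradiction n≡j n≢j
      ... | no  _   = refl

      pairLoad-deep : ∀ n → 2 ℕ.+ j ℕ.≤ n → ∀ v → Y n v ≡ 0ℤ
      pairLoad-deep (suc n) (s≤s j<n) v = pairLoad-off v (λ n≡j → ℕ.<⇒≢ j<n (sym n≡j))

      pairLoad-shallow : ∀ n → n ℕ.≤ j → ∀ v → Y n v ≡ 0ℤ
      pairLoad-shallow zero    _   v = refl
      pairLoad-shallow (suc n) n<j v = pairLoad-off v (ℕ.<⇒≢ n<j)

      childrenSum-atParents : ∀ r (v : Node d j) → childrenSum v (subtreeLoad Y r (suc j)) ≡ 0ℤ
      childrenSum-atParents r v = begin
        childrenSum v (subtreeLoad Y r (suc j))
          ≡⟨ childrenSum-cong v (λ u _ → trans (subtreeLoad-bottom Y (suc j) pairLoad-deep r u) (cong (Θ (suc r) *_) (pairLoad-on u))) ⟩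
        childrenSum v (λ u → Θ (suc r) * lastBranchSign u)
          ≡⟨ childrenSum-scale v (Θ (suc r)) lastBranchSign ⟩
        Θ (suc r) * childrenSum v lastBranchSign
          ≡⟨ cong (Θ (suc r) *_) (childrenSum-lastBranchSign v) ⟩
        Θ (suc r) * 0ℤ
          ≡⟨ *-zeroʳ (Θ (suc r)) ⟩
        0ℤ ∎

      subtreeLoad-above : ∀ r n v → n ℕ.≤ j → suc j ℕ.≤ n ℕ.+ r → subtreeLoad Y r n v ≡ 0ℤ
      subtreeLoad-above zero    n v n≤j j<n+0 = contradiction (subst (j <_) (ℕ.+-identityʳ n) j<n+0) (ℕ.≤⇒≯ n≤j)
      subtreeLoad-above (suc r) n v n≤j j<n+r = begin
        Θ (2 ℕ.+ r) * Y n v + childrenSum v (subtreeLoad Y r (suc n))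
          ≡⟨ cong₂ (λ y s → Θ (2 ℕ.+ r) * y + s) (pairLoad-shallow n n≤j v) (children (suc n ℕ.≤? j)) ⟩
        Θ (2 ℕ.+ r) * 0ℤ + 0ℤ
          ≡⟨ cong (_+ 0ℤ) (*-zeroʳ (Θ (2 ℕ.+ r))) ⟩
        0ℤ ∎
        where
        children : Dec (suc n ℕ.≤ j) → childrenSum v (subtreeLoad Y r (suc n)) ≡ 0ℤ
        children (yes n<j) = childrenSum-zero v (λ u → subtreeLoad-above r (suc n) u n<j (subst (suc j ℕ.≤_) (ℕ.+-suc n r) j<n+r))
        children (no  n≮j) with ℕ.≤-antisym n≤j (ℕ.≮⇒≥ n≮j)
        ... | refl = childrenSum-atParents r v

      j<h : j < h
      j<h = s≤s (ℕ.m∸n≤m h′ a)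

      potential-above : ∀ n v → n ℕ.≤ j → potential Y n v ≡ 0ℤ
      potential-above zero    root _   =
        trans (cong (+ K *_) (subtreeLoad-above h 0 root z≤n j<h)) (*-zeroʳ (+ K))
      potential-above (suc n) v    n<j = begin
        potential Y n (parent v) + + pairQuotient r * subtreeLoad Y r (suc n) v
          ≡⟨ cong₂ (λ t s → t + + pairQuotient r * s) (potential-above n (parent v) (ℕ.<⇒≤ n<j))
                   (subtreeLoad-above r (suc n) v n<j (subst (suc j ℕ.≤_) (sym (ℕ.m+[n∸m]≡n n<h)) j<h)) ⟩
        0ℤ + + pairQuotient r * 0ℤ
          ≡⟨ zeros (+ pairQuotient r) ⟩
        0ℤ ∎
        where
        r : ℕ
        r = h ∸ suc n
        n<h : suc n ℕ.≤ h
        n<h = ℕ.<-trans n<j j<h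
        zeros : ∀ a → 0ℤ + a * 0ℤ ≡ 0ℤ
        zeros = solve-∀

      green-spine : green Y (suc j , j<h , spine Fin.zero j) ≡ Θ (suc a) * (+ pairQuotient a * Θ (suc a))
      green-spine = begin
        green Y (suc j , j<h , spine Fin.zero j)
          ≡⟨ green-at Y j<h (spine Fin.zero j) height ⟩
        Θ (suc a) * potential Y (suc j) (spine Fin.zero j)
          ≡⟨ cong (Θ (suc a) *_) (potential-suc Y (spine Fin.zero j) height) ⟩
        Θ (suc a) * (potential Y j (parent (spine Fin.zero j)) + + pairQuotient a * subtreeLoad Y a (suc j) (spine Fin.zero j))
          ≡⟨ cong₂ (λ t s → Θ (suc a) * (t + + pairQuotient a * s)) (potential-above j _ ℕ.≤-refl)
                   (subtreeLoad-bottom Y (suc j) pairLoad-deep a (spine Fin.zero j)) ⟩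
        Θ (suc a) * (0ℤ + + pairQuotient a * (Θ (suc a) * Y (suc j) (spine Fin.zero j)))
          ≡⟨ cong (λ y → Θ (suc a) * (0ℤ + + pairQuotient a * (Θ (suc a) * y))) (trans (pairLoad-on _) (lastBranchSign-spine j)) ⟩
        Θ (suc a) * (0ℤ + + pairQuotient a * (Θ (suc a) * 1ℤ))
          ≡⟨ simplify (Θ (suc a)) (+ pairQuotient a) ⟩
        Θ (suc a) * (+ pairQuotient a * Θ (suc a)) ∎
        where
        height : h ∸ suc j ≡ a
        height = ℕ.m∸[m∸n]≡n a≤h′
        simplify : ∀ x κ → x * (0ℤ + κ * (x * 1ℤ)) ≡ x * (κ * x)
        simplify = solve-∀

    open Orders d h e using (Solution; DivisibleSolution)

    solvable : ∀ x → Σ (V → ℤ) (Solution x)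
    solvable x = green (extend x) , λ w → trans (green-solves (extend x) w) (cong (+ e *_) (atVertices-extend x w))

    +∣+*+⇒∣ : ∀ {a b c} → + a ℤ∣ + b * + c → a ∣ b ℕ.* c
    +∣+*+⇒∣ {a} {b} {c} a∣bc = subst (a ∣_) (cong ∣_∣ (sym (pos-* b c))) (∣⇒∣ᵤ a∣bc)

    module _ .{{e≢0 : ℕ.NonZero e}} (m : ℕ) (m-kills : ∀ x C → Solution x C → DivisibleSolution m C) where

      rootModulus∣ : rootModulus ∣ m
      rootModulus∣ = ∣.*-cancelˡ-∣ K {{ℕ.m*n≢0⇒m≢0 K {{subst ℕ.NonZero (_∣_.equality rootModulus∣e) e≢0}}}}
        (subst₂ _∣_ (_∣_.equality rootModulus∣e) (ℕ.*-comm m K) (+∣+*+⇒∣ {e} {m} {K} e∣mK))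
        where
        e∣mK : + e ℤ∣ + m * + K
        e∣mK = subst (λ g → + e ℤ∣ + m * g) green-sideLeaf
                 (m-kills (atVertices rootLoad) (green rootLoad) (green-solves rootLoad) (h , ℕ.≤-refl , sideLeaf h′))

      repunit∣ : ∀ a → a < h → repunit q (2 ℕ.+ a) ∣ m
      repunit∣ a a<h@(s≤s a≤h′) = coprime-divisor (Coprime.sym (repunit-coprime-suc q (suc a)))
        (∣.*-cancelˡ-∣ (r ℕ.* κ) {{ℕ.m*n≢0⇒m≢0 (r ℕ.* κ) {{subst ℕ.NonZero (e≡pairQuotient* a a<h) e≢0}}}}
          (subst₂ _∣_ (e≡pairQuotient* a a<h) (rearrange m r κ) (+∣+*+⇒∣ {e} {m} {r ℕ.* (κ ℕ.* r)} e∣mN)))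
        where
        open PairLoad a a≤h′
        r κ : ℕ
        r = repunit q (suc a)
        κ = pairQuotient a

        value : Θ (suc a) * (+ κ * Θ (suc a)) ≡ + (r ℕ.* (κ ℕ.* r))
        value = begin
          Θ (suc a) * (+ κ * Θ (suc a))   ≡⟨ cong₂ (λ x y → x * (+ κ * y)) (+repunit≡Θ (suc a)) (+repunit≡Θ (suc a)) ⟨
          + r * (+ κ * + r)               ≡⟨ cong (+ r *_) (pos-* κ r) ⟨
          + r * + (κ ℕ.* r)               ≡⟨ pos-* r (κ ℕ.* r) ⟨
          + (r ℕ.* (κ ℕ.* r))             ∎

        e∣mN : + e ℤ∣ + m * + (r ℕ.* (κ ℕ.* r))
        e∣mN = subst (λ g → + e ℤ∣ + m * g) (trans green-spine value)
                 (m-kills (atVertices Y) (green Y) (green-solves Y) (suc j , j<h , spine Fin.zero j))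

        rearrange : ∀ m r κ → m ℕ.* (r ℕ.* (κ ℕ.* r)) ≡ r ℕ.* κ ℕ.* (r ℕ.* m)
        rearrange = NatSolver.solve-∀

theorem2p3 : (d h : ℕ) → (d≥3 : 3 ≤ d) → 1 ≤ h →
    IsExponent d h (expFormula d d≥3 h)
theorem2p3 (suc (suc (suc k))) (suc h′) (s≤s (s≤s (s≤s z≤n))) (s≤s z≤n) =
  isExponent harmonic⇒zero solvable λ m m-kills → e∣ (rootModulus∣ m m-kills) (repunit∣ m m-kills)
  where
  open Repunits.ExponentFormula k h′ using (e; e-nonZero; rootModulus∣e; consecutive∣e; e∣)
  open Kernel k h′ using (harmonic⇒zero)
  open Green.ScaledInverse k h′ e rootModulus∣e consecutive∣e using (solvable; rootModulus∣; repunit∣)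
  open Orders (suc (suc (suc k))) (suc h′) e using (isExponent)
  instance
    _ = e-nonZero
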